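{- Let $\Delta \ge 3$ be an integer, and let $c_1,\dots,c_\Delta$ be the real numbers defined by $c_\Delta=\frac{1}{\Delta}$ and $ic_{i}+c_{i+1}=1$ for $i=1,\dots,\Delta-1$. Let $\varepsilon >0$ and $j\in \{1,\dots,\Delta\}$. Then there are infinitely many graphs $G\in \mathcal{G}_\Delta$ for which the inequality $$\alpha(G)\ge \varepsilon|V_j(G)|+\sum_{i=1}^\Delta c_i|V_i(G)|$$ does not hold.
   Context: All graphs are finite, simple and undirected. $\alpha(G)$ denotes the independence number of $G$. For an integer $\Delta\ge 3$, $\mathcal{G}_\Delta$ is the set of connected graphs $G\neq K_{\Delta+1}$ with maximum degree $\Delta$. For a graph $G$ and an integer $i\ge 1$, $V_i(G)$ denotes the set of vertices of $G$ of degree $i$.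
   Formalization: The parameter ε ranges over the positive rationals. -}

module Defs where

open import Data.Nat as ℕ using (ℕ; zero; suc; _≡ᵇ_)
open import Data.Fin using (Fin; zero; suc)
open import Data.Bool using (Bool; true; false; if_then_else_)
open import Data.Product using (Σ; _×_; ∃; ∃-syntax)
open import Data.Integer using (+_)
open import Data.Rational using (ℚ; 0ℚ; _+_; _/_)
open import Relation.Binary.PropositionalEquality using (_≡_; _≢_)
open import Relation.Nullary using (¬_)

record Graph : Set where
  field
    n     : ℕ
    adj   : Fin n → Fin n → Bool
    sym   : ∀ u v → adj u v ≡ adj v u
    irrefl : ∀ v → adj v v ≡ false
open Graph public

count : (m : ℕ) → (Fin m → Bool) → ℕ
count zero    p = 0
count (suc m) p = (if p zero then 1 else 0) ℕ.+ count m (λ x → p (suc x))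

deg : (G : Graph) → Fin (n G) → ℕ
deg G v = count (n G) (adj G v)

numDeg : (G : Graph) → ℕ → ℕ
numDeg G i = count (n G) (λ v → deg G v ≡ᵇ i)

MaxDegree : Graph → ℕ → Set
MaxDegree G Δ = (∀ v → deg G v ℕ.≤ Δ) × (∃[ v ] deg G v ≡ Δ)

data Reach (G : Graph) : Fin (n G) → Fin (n G) → Set where
  here : ∀ {u} → Reach G u u
  step : ∀ {u v w} → adj G u v ≡ true → Reach G v w → Reach G u w

Connected : Graph → Set
Connected G = ∀ u v → Reach G u v

IsComplete : Graph → ℕ → Set
IsComplete G m = (n G ≡ m) × (∀ u v → u ≢ v → adj G u v ≡ true)

InClass : ℕ → Graph → Set
InClass Δ G = Connected G × MaxDegree G Δ × ¬ IsComplete G (suc Δ)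

Independent : (G : Graph) → (Fin (n G) → Bool) → Set
Independent G S = ∀ u v → S u ≡ true → S v ≡ true → adj G u v ≡ false

IsIndependenceNumber : Graph → ℕ → Set
IsIndependenceNumber G k =
  (Σ (Fin (n G) → Bool) λ S → Independent G S × count (n G) S ≡ k)
  × (∀ S → Independent G S → count (n G) S ℕ.≤ k)

ℕ→ℚ : ℕ → ℚ
ℕ→ℚ m = + m / 1

sumFrom1 : ℕ → (ℕ → ℚ) → ℚ
sumFrom1 zero    f = 0ℚ
sumFrom1 (suc k) f = sumFrom1 k f + f (suc k)

-- Chain together m copies of K_Δ followed by one K_r (2 ≤ r ≤ Δ), joining consecutive cliques by
-- a single edge. Every vertex of a K_Δ has degree Δ - 1 or Δ, and the recurrence forces
-- c_{Δ-1} = c_Δ = 1/Δ, so each K_Δ contributes exactly 1 to Σᵢ cᵢ|Vᵢ|; the vertices of K_r have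
-- degrees r, r - 1, …, r - 1, contributing c_r + (r - 1) c_{r-1} = 1. Hence Σᵢ cᵢ|Vᵢ| = m + 1,
-- while an independent set meets each clique at most once, so α ≤ m + 1 and any positive
-- ε|V_j| breaks the inequality. Taking r = j + 1 (or r = Δ when j = Δ) puts a vertex in V_j, and
-- m is arbitrary.

module Submission where

open import Data.Nat as ℕ using (ℕ; suc; NonZero)
import Defs

module Counting where
  open import Data.Nat using (ℕ; zero; suc; _+_; _≤_; _<_; z≤n; s≤s; z<s; _≡ᵇ_; _<?_)
  open import Data.Nat.Properties
  open import Data.Bool using (Bool; true; false; if_then_else_; not; T)
  open import Data.Fin as Fin using (Fin; toℕ; fromℕ<)
  open import Data.Fin.Properties using (fromℕ<-toℕ; toℕ<n)
  open import Relation.Nullary using (yes; no)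
  open import Data.Product using (Σ; _×_; _,_; ∃-syntax)
  open import Data.Sum using (inj₁; inj₂)
  open import Data.Empty using (⊥-elim)
  open import Relation.Binary.PropositionalEquality
  open import Defs using (count)

  ≡ᵇ-refl : ∀ n → (n ≡ᵇ n) ≡ true
  ≡ᵇ-refl zero    = refl
  ≡ᵇ-refl (suc n) = ≡ᵇ-refl n

  ≡ᵇ-sym : ∀ m n → (m ≡ᵇ n) ≡ (n ≡ᵇ m)
  ≡ᵇ-sym zero    zero    = refl
  ≡ᵇ-sym zero    (suc n) = refl
  ≡ᵇ-sym (suc m) zero    = refl
  ≡ᵇ-sym (suc m) (suc n) = ≡ᵇ-sym m n

  ≡ᵇ-true⇒≡ : ∀ m n → (m ≡ᵇ n) ≡ true → m ≡ n
  ≡ᵇ-true⇒≡ m n eq = ≡ᵇ⇒≡ m n (subst T (sym eq) _)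

  ≢⇒≡ᵇ-false : ∀ {m n} → m ≢ n → (m ≡ᵇ n) ≡ false
  ≢⇒≡ᵇ-false {m} {n} m≢n with m ≡ᵇ n in eq
  ... | false = refl
  ... | true  = ⊥-elim (m≢n (≡ᵇ-true⇒≡ m n eq))

  indicator : Bool → ℕ
  indicator b = if b then 1 else 0

  countFrom : ℕ → ℕ → (ℕ → Bool) → ℕ
  countFrom a zero    p = 0
  countFrom a (suc l) p = indicator (p a) + countFrom (suc a) l p

  count≡countFrom : ∀ n a (q : Fin n → Bool) (p : ℕ → Bool) →
    (∀ x → q x ≡ p (a + toℕ x)) → count n q ≡ countFrom a n p
  count≡countFrom zero    a q p q≡p = refl
  count≡countFrom (suc n) a q p q≡p = cong₂ _+_
    (cong indicator (trans (q≡p Fin.zero) (cong p (+-identityʳ a))))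
    (count≡countFrom n (suc a) (λ x → q (Fin.suc x)) p (λ x → trans (q≡p (Fin.suc x)) (cong p (+-suc a (toℕ x)))))

  countFrom-+ : ∀ a l₁ l₂ p → countFrom a (l₁ + l₂) p ≡ countFrom a l₁ p + countFrom (a + l₁) l₂ p
  countFrom-+ a zero     l₂ p = cong (λ b → countFrom b l₂ p) (sym (+-identityʳ a))
  countFrom-+ a (suc l₁) l₂ p = begin
    indicator (p a) + countFrom (suc a) (l₁ + l₂) p
      ≡⟨ cong (indicator (p a) +_) (countFrom-+ (suc a) l₁ l₂ p) ⟩
    indicator (p a) + (countFrom (suc a) l₁ p + countFrom (suc a + l₁) l₂ p)
      ≡⟨ +-assoc (indicator (p a)) _ _ ⟨
    countFrom a (suc l₁) p + countFrom (suc a + l₁) l₂ p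
      ≡⟨ cong (λ b → countFrom a (suc l₁) p + countFrom b l₂ p) (+-suc a l₁) ⟨
    countFrom a (suc l₁) p + countFrom (a + suc l₁) l₂ p ∎
    where open ≡-Reasoning

  private
    <-+-suc : ∀ {x} a l → x < suc a + l → x < a + suc l
    <-+-suc {x} a l = subst (x <_) (sym (+-suc a l))

  countFrom-cong : ∀ a l {p q} → (∀ x → a ≤ x → x < a + l → p x ≡ q x) → countFrom a l p ≡ countFrom a l q
  countFrom-cong a zero    p≡q = refl
  countFrom-cong a (suc l) p≡q = cong₂ _+_ (cong indicator (p≡q a ≤-refl (m<m+n a z<s)))
    (countFrom-cong (suc a) l (λ x a<x x<a+l → p≡q x (<⇒≤ a<x) (<-+-suc a l x<a+l)))

  countFrom-false : ∀ a l p → (∀ x → a ≤ x → x < a + l → p x ≡ false) → countFrom a l p ≡ 0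
  countFrom-false a l p p≡false = trans (countFrom-cong a l p≡false) (countFrom-const-false a l)
    where
    countFrom-const-false : ∀ a l → countFrom a l (λ _ → false) ≡ 0
    countFrom-const-false a zero    = refl
    countFrom-const-false a (suc l) = countFrom-const-false (suc a) l

  countFrom-witness : ∀ a l p → 1 ≤ countFrom a l p → ∃[ x ] (a ≤ x × x < a + l × p x ≡ true)
  countFrom-witness a (suc l) p 1≤count with p a in pa
  ... | true  = a , ≤-refl , m<m+n a z<s , pa
  ... | false with countFrom-witness (suc a) l p 1≤count
  ...   | x , a<x , x<a+l , px = x , <⇒≤ a<x , <-+-suc a l x<a+l , px

  countFrom-≤1 : ∀ a l p → (∀ x y → a ≤ x → x < a + l → a ≤ y → y < a + l → p x ≡ true → p y ≡ true → x ≡ y) →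
    countFrom a l p ≤ 1
  countFrom-≤1 a zero    p unique = z≤n
  countFrom-≤1 a (suc l) p unique with p a in pa
  ... | true  = s≤s (≤-reflexive (countFrom-false (suc a) l p rest-false))
    where
    rest-false : ∀ x → suc a ≤ x → x < suc a + l → p x ≡ false
    rest-false x a<x x<a+l with p x in px
    ... | false = refl
    ... | true  = ⊥-elim (<-irrefl (unique a x ≤-refl (m<m+n a z<s) (<⇒≤ a<x) (<-+-suc a l x<a+l) pa px) a<x)
  ... | false = countFrom-≤1 (suc a) l p (λ x y a<x x<a+l a<y y<a+l →
                  unique x y (<⇒≤ a<x) (<-+-suc a l x<a+l) (<⇒≤ a<y) (<-+-suc a l y<a+l))

  countFrom-≥1 : ∀ a l p x → a ≤ x → x < a + l → p x ≡ true → 1 ≤ countFrom a l p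
  countFrom-≥1 a (suc l) p x a≤x x<a+l px with p a in pa
  ... | true  = s≤s z≤n
  ... | false with m≤n⇒m<n∨m≡n a≤x
  ...   | inj₁ a<x  = countFrom-≥1 (suc a) l p x a<x (subst (x <_) (+-suc a l) x<a+l) px
  ...   | inj₂ refl with () ← trans (sym px) pa
  countFrom-≥1 a zero p x a≤x x<a+l px = ⊥-elim (<-irrefl refl (≤-<-trans a≤x (subst (x <_) (+-identityʳ a) x<a+l)))

  countFrom-not : ∀ a l p → countFrom a l (λ x → not (p x)) + countFrom a l p ≡ l
  countFrom-not a zero    p = refl
  countFrom-not a (suc l) p with p a
  ... | true  = trans (+-suc _ _) (cong suc (countFrom-not (suc a) l p))
  ... | false = cong suc (countFrom-not (suc a) l p)

  countFrom-≡ᵇ : ∀ a l y → a ≤ y → y < a + l → countFrom a l (y ≡ᵇ_) ≡ 1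
  countFrom-≡ᵇ a l y a≤y y<a+l = ≤-antisym
    (countFrom-≤1 a l (y ≡ᵇ_) (λ x x′ _ _ _ _ y≡x y≡x′ → trans (sym (≡ᵇ-true⇒≡ y x y≡x)) (≡ᵇ-true⇒≡ y x′ y≡x′)))
    (countFrom-≥1 a l (y ≡ᵇ_) y a≤y y<a+l (≡ᵇ-refl y))

  countFrom-≢ : ∀ a l y → a ≤ y → y < a + l → suc (countFrom a l (λ x → not (y ≡ᵇ x))) ≡ l
  countFrom-≢ a l y a≤y y<a+l = begin
    suc (countFrom a l (λ x → not (y ≡ᵇ x)))              ≡⟨ +-comm 1 _ ⟩
    countFrom a l (λ x → not (y ≡ᵇ x)) + 1                 ≡⟨ cong (countFrom a l (λ x → not (y ≡ᵇ x)) +_)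
                                                                   (countFrom-≡ᵇ a l y a≤y y<a+l) ⟨
    countFrom a l (λ x → not (y ≡ᵇ x)) + countFrom a l (y ≡ᵇ_) ≡⟨ countFrom-not a l (y ≡ᵇ_) ⟩
    l                                                      ∎
    where open ≡-Reasoning

  module _ {n : ℕ} (S : Fin n → Bool) where

    extend : ℕ → Bool
    extend x with x <? n
    ... | yes x<n = S (fromℕ< x<n)
    ... | no  _   = false

    count≡countFrom-extend : count n S ≡ countFrom 0 n extend
    count≡countFrom-extend = count≡countFrom n 0 S extend S≡extend
      where
      S≡extend : ∀ v → S v ≡ extend (toℕ v)
      S≡extend v with toℕ v <? n
      ... | yes v<n = cong S (sym (fromℕ<-toℕ v v<n))
      ... | no  v≮n = ⊥-elim (v≮n (toℕ<n v))

    extend-true : ∀ x → extend x ≡ true → Σ (x < n) λ x<n → S (fromℕ< x<n) ≡ true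
    extend-true x Sx with x <? n
    ... | yes x<n = x<n , Sx

module Connectivity (G : Defs.Graph) where
  open import Data.Nat using (ℕ; zero; suc; _+_; _∸_; _≤_; _<_; s≤s)
  open import Data.Nat.Properties using (+-identityʳ; +-suc; ≤-total; m+[n∸m]≡n; ≤-<-trans; m≤m+n)
  open import Data.Fin using (Fin; toℕ; fromℕ<)
  open import Data.Fin.Properties using (toℕ-injective; toℕ-fromℕ<; toℕ<n)
  open import Data.Bool using (true)
  open import Data.Sum using (inj₁; inj₂)
  open import Relation.Binary.PropositionalEquality
  open import Defs using (n; adj; Reach; here; step; Connected)
  open Defs.Graph G using () renaming (sym to adj-sym)

  Reach-trans : ∀ {u v w} → Reach G u v → Reach G v w → Reach G u w
  Reach-trans here         v⇝w = v⇝w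
  Reach-trans (step uv v⇝) v⇝w = step uv (Reach-trans v⇝ v⇝w)

  Reach-sym : ∀ {u v} → Reach G u v → Reach G v u
  Reach-sym here                 = here
  Reach-sym (step {u} {v} uv v⇝) = Reach-trans (Reach-sym v⇝) (step (trans (adj-sym v u) uv) here)

  module _ (consecutive : ∀ u (1+u<n : suc (toℕ u) < n G) → adj G u (fromℕ< 1+u<n) ≡ true) where

    Reach-forward : ∀ j (u v : Fin (n G)) → toℕ v ≡ toℕ u + j → Reach G u v
    Reach-forward zero    u v v≡u+0 = subst (Reach G u) (toℕ-injective (trans (sym (+-identityʳ (toℕ u))) (sym v≡u+0))) here
    Reach-forward (suc j) u v v≡u+1+j = step (consecutive u 1+u<n)
      (Reach-forward j (fromℕ< 1+u<n) v (trans v≡u+1+j (trans (+-suc (toℕ u) j) (cong (_+ j) (sym (toℕ-fromℕ< 1+u<n))))))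
      where
      1+u<n : suc (toℕ u) < n G
      1+u<n = ≤-<-trans (subst (suc (toℕ u) ≤_) (sym (trans v≡u+1+j (+-suc (toℕ u) j))) (s≤s (m≤m+n (toℕ u) j))) (toℕ<n v)

    connected-if-consecutive : Connected G
    connected-if-consecutive u v with ≤-total (toℕ u) (toℕ v)
    ... | inj₁ u≤v = Reach-forward (toℕ v ∸ toℕ u) u v (sym (m+[n∸m]≡n u≤v))
    ... | inj₂ v≤u = Reach-sym (Reach-forward (toℕ u ∸ toℕ v) v u (sym (m+[n∸m]≡n v≤u)))

module ChainOfCliques (d-1 m r : ℕ) (1≤m : 1 ℕ.≤ m) (2≤r : 2 ℕ.≤ r) (r≤d : r ℕ.≤ suc d-1) where
  open import Data.Nat using (zero; _+_; _*_; _∸_; _≤_; _<_; z≤n; s≤s; z<s; _≡ᵇ_; _/_; _<?_; _≟_)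
  open import Data.Nat.Properties
  open import Data.Nat.DivMod using (m*n/n≡m; /-monoˡ-≤; m<n*o⇒m/o<n; m/n*n≤m; m≡m%n+[m/n]*n; m%n<n)
  open import Data.Nat.Solver using (module +-*-Solver)
  open import Data.Bool using (Bool; true; false; not; _∧_; _∨_)
  open import Data.Fin using (toℕ; fromℕ<)
  open import Data.Fin.Properties using (toℕ-fromℕ<; toℕ<n)
  open import Data.Product using (Σ; _×_; _,_; proj₂)
  open import Data.Sum using (_⊎_; inj₁; inj₂)
  open import Data.Empty using (⊥-elim)
  open import Relation.Nullary using (¬_; yes; no)
  open import Relation.Binary.PropositionalEquality
  open Counting
  open import Defs using (Graph; adj; count; deg; numDeg; Connected; MaxDegree; IsComplete; Independent)

  d : ℕ
  d = suc d-1

  -- Vertices are 0 … order - 1; vertex x lies in block x / d. Blocks 0 … m - 1 are cliques of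
  -- size d, block m is a clique of size r, and consecutive vertices are adjacent.
  order : ℕ
  order = m * d + r

  adjacent : ℕ → ℕ → Bool
  adjacent u v = not (u ≡ᵇ v) ∧ ((u / d ≡ᵇ v / d) ∨ ((suc u ≡ᵇ v) ∨ (suc v ≡ᵇ u)))

  adjacent-sym : ∀ u v → adjacent u v ≡ adjacent v u
  adjacent-sym u v rewrite ≡ᵇ-sym u v | ≡ᵇ-sym (u / d) (v / d)
    with v ≡ᵇ u | v / d ≡ᵇ u / d | suc u ≡ᵇ v | suc v ≡ᵇ u
  ... | true  | _     | _     | _     = refl
  ... | false | true  | _     | _     = refl
  ... | false | false | true  | true  = refl
  ... | false | false | true  | false = refl
  ... | false | false | false | true  = refl
  ... | false | false | false | false = refl

  adjacent-irrefl : ∀ u → adjacent u u ≡ false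
  adjacent-irrefl u rewrite ≡ᵇ-refl u = refl

  adjacent-suc : ∀ u → adjacent u (suc u) ≡ true
  adjacent-suc u rewrite ≢⇒≡ᵇ-false (λ u≡1+u → <-irrefl u≡1+u (n<1+n u)) | ≡ᵇ-refl u with u / d ≡ᵇ suc u / d
  ... | true  = refl
  ... | false = refl

  block-index-≥ : ∀ b x → b * d ≤ x → b ≤ x / d
  block-index-≥ b x bd≤x = subst (_≤ x / d) (m*n/n≡m b d) (/-monoˡ-≤ d bd≤x)

  block-index : ∀ b x → b * d ≤ x → x < b * d + d → x / d ≡ b
  block-index b x bd≤x x<bd+d = ≤-antisym
    (≤-pred (m<n*o⇒m/o<n (subst (x <_) (+-comm (b * d) d) x<bd+d)))
    (block-index-≥ b x bd≤x)

  module Neighbours (b v : ℕ) (bd≤v : b * d ≤ v) (v<bd+d : v < b * d + d) where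

    adjacent-before : ∀ x → x < b * d → adjacent v x ≡ (suc x ≡ᵇ v)
    adjacent-before x x<bd
      rewrite ≢⇒≡ᵇ-false (λ v≡x → <-irrefl (sym v≡x) (<-≤-trans x<bd bd≤v))
            | ≢⇒≡ᵇ-false {v / d} {x / d} (λ v/d≡x/d → <-irrefl (trans (sym v/d≡x/d) (block-index b v bd≤v v<bd+d))
                                                             (m<n*o⇒m/o<n x<bd))
            | ≢⇒≡ᵇ-false (λ 1+v≡x → <-irrefl (sym 1+v≡x) (<-trans (<-≤-trans x<bd bd≤v) (n<1+n v)))
      = refl

    adjacent-within : ∀ x → b * d ≤ x → x < b * d + d → adjacent v x ≡ not (v ≡ᵇ x)
    adjacent-within x bd≤x x<bd+d rewrite block-index b v bd≤v v<bd+d | block-index b x bd≤x x<bd+d | ≡ᵇ-refl b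
      with v ≡ᵇ x
    ... | true  = refl
    ... | false = refl

    adjacent-after : ∀ x → b * d + d ≤ x → adjacent v x ≡ (suc v ≡ᵇ x)
    adjacent-after x bd+d≤x
      rewrite ≢⇒≡ᵇ-false (λ v≡x → <-irrefl v≡x (<-≤-trans v<bd+d bd+d≤x))
            | ≢⇒≡ᵇ-false {v / d} {x / d} (λ v/d≡x/d → <-irrefl (trans (sym (block-index b v bd≤v v<bd+d)) v/d≡x/d)
                                                             (block-index-≥ (suc b) x (subst (_≤ x) (+-comm (b * d) d) bd+d≤x)))
            | ≢⇒≡ᵇ-false (λ 1+x≡v → <-irrefl (sym 1+x≡v) (<-trans (<-≤-trans v<bd+d bd+d≤x) (n<1+n x)))
      with suc v ≡ᵇ x
    ... | true  = refl
    ... | false = refl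

  degree : ℕ → ℕ
  degree v = countFrom 0 order (adjacent v)

  predecessors : ℕ → ℕ → ℕ
  predecessors a v = countFrom 0 a (λ x → suc x ≡ᵇ v)

  successors : ℕ → ℕ → ℕ → ℕ
  successors a l v = countFrom a l (suc v ≡ᵇ_)

  predecessors≤1 : ∀ a v → predecessors a v ≤ 1
  predecessors≤1 a v = countFrom-≤1 0 a _ λ x y _ _ _ _ 1+x≡v 1+y≡v →
    suc-injective (trans (≡ᵇ-true⇒≡ (suc x) v 1+x≡v) (sym (≡ᵇ-true⇒≡ (suc y) v 1+y≡v)))

  predecessors≡1⇒≤ : ∀ a v → predecessors a v ≡ 1 → v ≤ a
  predecessors≡1⇒≤ a v one with countFrom-witness 0 a _ (≤-reflexive (sym one))
  ... | x , _ , x<a , 1+x≡v = subst (_≤ a) (≡ᵇ-true⇒≡ (suc x) v 1+x≡v) x<a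

  successors≤1 : ∀ a l v → successors a l v ≤ 1
  successors≤1 a l v = countFrom-≤1 a l _ λ x y _ _ _ _ 1+v≡x 1+v≡y →
    trans (sym (≡ᵇ-true⇒≡ (suc v) x 1+v≡x)) (≡ᵇ-true⇒≡ (suc v) y 1+v≡y)

  successors≡1⇒≤ : ∀ a l v → successors a l v ≡ 1 → a ≤ suc v
  successors≡1⇒≤ a l v one with countFrom-witness a l _ (≤-reflexive (sym one))
  ... | x , a≤x , _ , 1+v≡x = subst (a ≤_) (sym (≡ᵇ-true⇒≡ (suc v) x 1+v≡x)) a≤x

  degree-full-block : ∀ b t v → b + suc t ≡ m → b * d ≤ v → v < b * d + d →
    degree v ≡ predecessors (b * d) v + (countFrom (b * d) d (λ x → not (v ≡ᵇ x)) + successors (b * d + d) (t * d + r) v)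
  degree-full-block b t v b+1+t≡m bd≤v v<bd+d = begin
    countFrom 0 order (adjacent v)
      ≡⟨ cong (λ l → countFrom 0 l (adjacent v)) order≡ ⟩
    countFrom 0 (b * d + (d + (t * d + r))) (adjacent v)
      ≡⟨ countFrom-+ 0 (b * d) _ (adjacent v) ⟩
    countFrom 0 (b * d) (adjacent v) + countFrom (b * d) (d + (t * d + r)) (adjacent v)
      ≡⟨ cong (countFrom 0 (b * d) (adjacent v) +_) (countFrom-+ (b * d) d _ (adjacent v)) ⟩
    countFrom 0 (b * d) (adjacent v) + (countFrom (b * d) d (adjacent v) + countFrom (b * d + d) (t * d + r) (adjacent v))
      ≡⟨ cong₂ _+_ (countFrom-cong 0 (b * d) λ x _ x<bd → adjacent-before x x<bd)
                   (cong₂ _+_ (countFrom-cong (b * d) d λ x bd≤x x<bd+d → adjacent-within x bd≤x x<bd+d)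
                              (countFrom-cong (b * d + d) (t * d + r) λ x bd+d≤x _ → adjacent-after x bd+d≤x)) ⟩
    predecessors (b * d) v + (countFrom (b * d) d (λ x → not (v ≡ᵇ x)) + successors (b * d + d) (t * d + r) v) ∎
    where
    open ≡-Reasoning
    open Neighbours b v bd≤v v<bd+d
    order≡ : order ≡ b * d + (d + (t * d + r))
    order≡ = trans (cong (λ m → m * d + r) (sym b+1+t≡m))
      (solve 4 (λ b t d r → (b :+ (con 1 :+ t)) :* d :+ r := b :* d :+ (d :+ (t :* d :+ r))) refl b t d r)
      where open +-*-Solver

  degree-last-block : ∀ v → m * d ≤ v → v < order →
    degree v ≡ predecessors (m * d) v + countFrom (m * d) r (λ x → not (v ≡ᵇ x))
  degree-last-block v md≤v v<order = trans (countFrom-+ 0 (m * d) r (adjacent v))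
    (cong₂ _+_ (countFrom-cong 0 (m * d) λ x _ x<md → adjacent-before x x<md)
               (countFrom-cong (m * d) r λ x md≤x x<order → adjacent-within x md≤x (r-bound x<order)))
    where
    r-bound : ∀ {x} → x < m * d + r → x < m * d + d
    r-bound x<order = <-≤-trans x<order (+-monoʳ-≤ (m * d) r≤d)
    open Neighbours m v md≤v (r-bound v<order)

  2≤d : 2 ≤ d
  2≤d = ≤-trans 2≤r r≤d

  module _ (b t v : ℕ) (b+1+t≡m : b + suc t ≡ m) (bd≤v : b * d ≤ v) (v<bd+d : v < b * d + d) where
    private
      degree≡ : ∀ {L R} → predecessors (b * d) v ≡ L → successors (b * d + d) (t * d + r) v ≡ R → degree v ≡ L + (d-1 + R)
      degree≡ L≡ R≡ = trans (degree-full-block b t v b+1+t≡m bd≤v v<bd+d)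
        (cong₂ _+_ L≡ (cong₂ _+_ (suc-injective (countFrom-≢ (b * d) d v bd≤v v<bd+d)) R≡))

    degree-in-full-block : degree v ≡ d-1 ⊎ degree v ≡ d
    degree-in-full-block
      with n≤1⇒n≡0∨n≡1 (predecessors≤1 (b * d) v) | n≤1⇒n≡0∨n≡1 (successors≤1 (b * d + d) (t * d + r) v)
    ... | inj₁ L≡0 | inj₁ R≡0 = inj₁ (trans (degree≡ L≡0 R≡0) (+-identityʳ d-1))
    ... | inj₁ L≡0 | inj₂ R≡1 = inj₂ (trans (degree≡ L≡0 R≡1) (+-comm d-1 1))
    ... | inj₂ L≡1 | inj₁ R≡0 = inj₂ (trans (degree≡ L≡1 R≡0) (cong suc (+-identityʳ d-1)))
    ... | inj₂ L≡1 | inj₂ R≡1 = ⊥-elim (<-irrefl refl (<-≤-trans (≤-trans 2≤d d≤1) (s≤s z≤n)))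
      where
      -- a vertex with a predecessor outside its block is the block's first vertex, one with a
      -- successor outside is its last; they coincide only for blocks of size 1
      d≤1 : d ≤ 1
      d≤1 = +-cancelˡ-≤ (b * d) d 1 (≤-trans (successors≡1⇒≤ (b * d + d) (t * d + r) v R≡1)
              (subst (suc v ≤_) (+-comm 1 (b * d)) (s≤s (predecessors≡1⇒≤ (b * d) v L≡1))))

  predecessors-self : ∀ a → 1 ≤ a → predecessors a a ≡ 1
  predecessors-self (suc a) _ = ≤-antisym (predecessors≤1 (suc a) (suc a)) (countFrom-≥1 0 (suc a) _ a z≤n ≤-refl (≡ᵇ-refl a))

  predecessors-far : ∀ a v → a < v → predecessors a v ≡ 0
  predecessors-far a v a<v = countFrom-false 0 a _ λ x _ x<a →
    ≢⇒≡ᵇ-false {suc x} {v} (λ 1+x≡v → <-irrefl 1+x≡v (<-≤-trans (s≤s x<a) a<v))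

  1≤md : 1 ≤ m * d
  1≤md = *-mono-≤ 1≤m (s≤s z≤n)

  md<order : m * d < order
  md<order = m<m+n (m * d) (≤-trans (s≤s z≤n) 2≤r)

  degree-first-of-last-block : degree (m * d) ≡ r
  degree-first-of-last-block = begin
    degree (m * d)                      ≡⟨ degree-last-block (m * d) ≤-refl md<order ⟩
    predecessors (m * d) (m * d) + rest ≡⟨ cong (_+ rest) (predecessors-self (m * d) 1≤md) ⟩
    suc rest                            ≡⟨ countFrom-≢ (m * d) r (m * d) ≤-refl md<order ⟩
    r                                   ∎
    where
    open ≡-Reasoning
    rest = countFrom (m * d) r (λ x → not (m * d ≡ᵇ x))

  degree-rest-of-last-block : ∀ v → m * d < v → v < order → suc (degree v) ≡ r
  degree-rest-of-last-block v md<v v<order = begin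
    suc (degree v)                        ≡⟨ cong suc (degree-last-block v (<⇒≤ md<v) v<order) ⟩
    suc (predecessors (m * d) v + rest)   ≡⟨ cong (λ L → suc (L + rest)) (predecessors-far (m * d) v md<v) ⟩
    suc rest                              ≡⟨ countFrom-≢ (m * d) r v (<⇒≤ md<v) v<order ⟩
    r                                     ∎
    where
    open ≡-Reasoning
    rest = countFrom (m * d) r (λ x → not (v ≡ᵇ x))

  degree-last-of-first-block : degree d-1 ≡ d
  degree-last-of-first-block = begin
    degree d-1
      ≡⟨ degree-full-block 0 t d-1 0+1+t≡m z≤n ≤-refl ⟩
    countFrom 0 d (λ x → not (d-1 ≡ᵇ x)) + successors d (t * d + r) d-1
      ≡⟨ cong₂ _+_ (suc-injective (countFrom-≢ 0 d d-1 z≤n ≤-refl)) successor ⟩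
    d-1 + 1
      ≡⟨ +-comm d-1 1 ⟩
    d ∎
    where
    open ≡-Reasoning
    t = m ∸ 1
    0+1+t≡m : 0 + suc t ≡ m
    0+1+t≡m = m+[n∸m]≡n 1≤m
    successor : successors d (t * d + r) d-1 ≡ 1
    successor = countFrom-≡ᵇ d (t * d + r) d ≤-refl (m<m+n d (<-≤-trans (s≤s z≤n) (≤-trans 2≤r (m≤n+m r (t * d)))))

  vertex-position : ∀ x → x < order →
    (Σ ℕ λ b → Σ ℕ λ t → b + suc t ≡ m × b * d ≤ x × x < b * d + d) ⊎ m * d ≤ x
  vertex-position x x<order with x <? m * d
  ... | no  x≮md = inj₂ (≮⇒≥ x≮md)
  ... | yes x<md = inj₁ (x / d , m ∸ suc (x / d) , trans (+-suc (x / d) _) (m+[n∸m]≡n (m<n*o⇒m/o<n x<md)) , m/n*n≤m x d , x<x/d*d+d)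
    where
    x<x/d*d+d : x < x / d * d + d
    x<x/d*d+d = subst₂ _<_ (sym (m≡m%n+[m/n]*n x d)) (+-comm d (x / d * d)) (+-monoˡ-< (x / d * d) (m%n<n x d))

  degree-bounds : ∀ x → x < order → 1 ≤ degree x × degree x ≤ d
  degree-bounds x x<order with vertex-position x x<order
  ... | inj₁ (b , t , b+1+t≡m , bd≤x , x<bd+d) with degree-in-full-block b t x b+1+t≡m bd≤x x<bd+d
  ...   | inj₁ deg≡d-1 = subst (λ k → 1 ≤ k × k ≤ d) (sym deg≡d-1) (≤-pred 2≤d , n≤1+n d-1)
  ...   | inj₂ deg≡d   = subst (λ k → 1 ≤ k × k ≤ d) (sym deg≡d) (≤-trans (s≤s z≤n) 2≤d , ≤-refl)
  degree-bounds x x<order | inj₂ md≤x with m≤n⇒m<n∨m≡n md≤x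
  ... | inj₂ refl  = subst (λ k → 1 ≤ k × k ≤ d) (sym degree-first-of-last-block) (≤-trans (s≤s z≤n) 2≤r , r≤d)
  ... | inj₁ md<x  = s≤s≤ (subst (λ k → 2 ≤ k × k ≤ d) (sym (degree-rest-of-last-block x md<x x<order)) (2≤r , r≤d))
    where
    s≤s≤ : ∀ {k} → 2 ≤ suc k × suc k ≤ d → 1 ≤ k × k ≤ d
    s≤s≤ (2≤1+k , 1+k≤d) = ≤-pred 2≤1+k , ≤-trans (n≤1+n _) 1+k≤d

  AtMostOnePerBlock : (ℕ → Bool) → Set
  AtMostOnePerBlock p =
    ∀ b x y → b * d ≤ x → x < b * d + d → b * d ≤ y → y < b * d + d → p x ≡ true → p y ≡ true → x ≡ y

  module _ (p : ℕ → Bool) (one-per-block : AtMostOnePerBlock p) where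

    countFrom-blocks≤ : ∀ t b → b + t ≡ m → countFrom (b * d) (t * d + r) p ≤ suc t
    countFrom-blocks≤ zero    b _ = countFrom-≤1 (b * d) r p λ x y bd≤x x<bd+r bd≤y y<bd+r →
      one-per-block b x y bd≤x (<-≤-trans x<bd+r (+-monoʳ-≤ (b * d) r≤d)) bd≤y (<-≤-trans y<bd+r (+-monoʳ-≤ (b * d) r≤d))
    countFrom-blocks≤ (suc t) b b+1+t≡m = begin
      countFrom (b * d) (suc t * d + r) p                         ≡⟨ cong (λ l → countFrom (b * d) l p) (+-assoc d (t * d) r) ⟩
      countFrom (b * d) (d + (t * d + r)) p                       ≡⟨ countFrom-+ (b * d) d _ p ⟩
      countFrom (b * d) d p + countFrom (b * d + d) (t * d + r) p ≡⟨ cong (λ a → countFrom (b * d) d p + countFrom a (t * d + r) p)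
                                                                           (+-comm (b * d) d) ⟩
      countFrom (b * d) d p + countFrom (suc b * d) (t * d + r) p ≤⟨ +-mono-≤ (countFrom-≤1 (b * d) d p (one-per-block b))
                                                                           (countFrom-blocks≤ t (suc b) (trans (sym (+-suc b t)) b+1+t≡m)) ⟩
      suc (suc t)                                                 ∎
      where open ≤-Reasoning

  d≤md : d ≤ m * d
  d≤md = subst (_≤ m * d) (*-identityˡ d) (*-monoˡ-≤ d 1≤m)

  chain : Graph
  chain = record
    { n      = order
    ; adj    = λ u v → adjacent (toℕ u) (toℕ v)
    ; sym    = λ u v → adjacent-sym (toℕ u) (toℕ v)
    ; irrefl = λ v → adjacent-irrefl (toℕ v)
    }

  deg≡degree : ∀ v → deg chain v ≡ degree (toℕ v)
  deg≡degree v = count≡countFrom order 0 (adj chain v) (adjacent (toℕ v)) (λ _ → refl)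

  numDeg≡countFrom : ∀ i → numDeg chain i ≡ countFrom 0 order (λ x → degree x ≡ᵇ i)
  numDeg≡countFrom i = count≡countFrom order 0 _ _ (λ v → cong (_≡ᵇ i) (deg≡degree v))

  chain-connected : Connected chain
  chain-connected = connected-if-consecutive λ u 1+u<order →
    subst (λ y → adjacent (toℕ u) y ≡ true) (sym (toℕ-fromℕ< 1+u<order)) (adjacent-suc (toℕ u))
    where open Connectivity chain

  chain-maxDegree : MaxDegree chain d
  chain-maxDegree = (λ v → subst (_≤ d) (sym (deg≡degree v)) (proj₂ (degree-bounds (toℕ v) (toℕ<n v))))
                  , fromℕ< d-1<order
                  , trans (deg≡degree (fromℕ< d-1<order)) (trans (cong degree (toℕ-fromℕ< d-1<order)) degree-last-of-first-block)
    where
    d-1<order : d-1 < order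
    d-1<order = <-≤-trans (n<1+n d-1) (≤-trans d≤md (m≤m+n (m * d) r))

  chain-not-complete : ¬ IsComplete chain (suc d)
  chain-not-complete (order≡1+d , _) = <-irrefl (sym order≡1+d) 1+d<order
    where
    1+d<order : suc d < order
    1+d<order = ≤-trans (subst (_≤ d + r) (+-comm d 2) (+-monoʳ-≤ d 2≤r)) (+-monoˡ-≤ r d≤md)

  chain-independent≤ : ∀ S → Independent chain S → count order S ≤ suc m
  chain-independent≤ S independent = subst (_≤ suc m) (sym (count≡countFrom-extend S)) (countFrom-blocks≤ (extend S) one-per-block m 0 refl)
    where
    one-per-block : AtMostOnePerBlock (extend S)
    one-per-block b x y bd≤x x<bd+d bd≤y y<bd+d Sx Sy with x ≟ y | extend-true S x Sx | extend-true S y Sy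
    ... | yes x≡y | _ | _ = x≡y
    ... | no  x≢y | x<order , Sx′ | y<order , Sy′
      with () ← trans (sym (subst₂ (λ u w → adjacent u w ≡ false) (toℕ-fromℕ< x<order) (toℕ-fromℕ< y<order) (independent _ _ Sx′ Sy′)))
                      (trans (Neighbours.adjacent-within b x bd≤x x<bd+d y bd≤y y<bd+d) (cong not (≢⇒≡ᵇ-false x≢y)))

  numDeg-degree≥1 : ∀ x → x < order → 1 ≤ numDeg chain (degree x)
  numDeg-degree≥1 x x<order = subst (1 ≤_) (sym (numDeg≡countFrom (degree x)))
    (countFrom-≥1 0 order (λ y → degree y ≡ᵇ degree x) x z≤n x<order (≡ᵇ-refl (degree x)))

  numDeg-d≥1 : 1 ≤ numDeg chain d
  numDeg-d≥1 = subst (λ k → 1 ≤ numDeg chain k) degree-last-of-first-block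
    (numDeg-degree≥1 d-1 (<-≤-trans (n<1+n d-1) (≤-trans d≤md (m≤m+n (m * d) r))))

  numDeg-r-1≥1 : 1 ≤ numDeg chain (r ∸ 1)
  numDeg-r-1≥1 = subst (λ k → 1 ≤ numDeg chain k) (cong (_∸ 1) (degree-rest-of-last-block (suc (m * d)) ≤-refl 1+md<order))
    (numDeg-degree≥1 (suc (m * d)) 1+md<order)
    where
    1+md<order : suc (m * d) < order
    1+md<order = subst (_< order) (+-comm (m * d) 1) (+-monoʳ-< (m * d) 2≤r)

open import Defs hiding (sym)
open import Data.Product using (Σ; _×_; _,_)
open import Data.Integer using (+_)
open import Data.Rational using (ℚ; 0ℚ; 1ℚ; _+_; _*_; _/_; _<_; _≤_)
open import Relation.Binary.PropositionalEquality using (_≡_; refl)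
open import Relation.Nullary using (¬_)
open import Data.Nat.Properties using (n<1+n; ≤-refl; ≤-pred; m≤n⇒m<n∨m≡n)
open import Data.Sum using (inj₁; inj₂)

module EmbeddingProperties where
  import Data.Nat.Properties as ℕ
  import Data.Nat.Coprimality as Coprime
  import Data.Integer as ℤ
  import Data.Integer.Properties as ℤ
  open import Data.Rational using (mkℚ; 1/_)
  open import Data.Rational.Properties
  open import Data.Rational.Solver using (module +-*-Solver)
  open import Algebra.Properties.Group +-0-group using (∙-cancelʳ)
  open import Relation.Binary.PropositionalEquality
  open import Defs using (ℕ→ℚ)

  ℕ→ℚ≡mkℚ : ∀ a → ℕ→ℚ a ≡ mkℚ (+ a) 0 (Coprime.sym (Coprime.1-coprimeTo a))
  ℕ→ℚ≡mkℚ a = normalize-coprime (Coprime.sym (Coprime.1-coprimeTo a))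

  ℕ→ℚ-homo-+ : ∀ a b → ℕ→ℚ (a ℕ.+ b) ≡ ℕ→ℚ a + ℕ→ℚ b
  ℕ→ℚ-homo-+ a b = begin
    ℕ→ℚ (a ℕ.+ b)                     ≡⟨ /-cong {q₁ = 1} (cong₂ ℤ._+_ (ℤ.*-identityʳ (+ a)) (ℤ.*-identityʳ (+ b))) refl ⟨
    (+ a ℤ.* + 1 ℤ.+ + b ℤ.* + 1) / 1 ≡⟨ cong₂ _+_ (ℕ→ℚ≡mkℚ a) (ℕ→ℚ≡mkℚ b) ⟨
    ℕ→ℚ a + ℕ→ℚ b                     ∎
    where open ≡-Reasoning

  ℕ→ℚ-nonNegative : ∀ a → 0ℚ ≤ ℕ→ℚ a
  ℕ→ℚ-nonNegative a = subst (0ℚ ≤_) (sym (ℕ→ℚ≡mkℚ a)) (nonNegative⁻¹ _)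

  ℕ→ℚ-positive : ∀ a → 1 ℕ.≤ a → 0ℚ < ℕ→ℚ a
  ℕ→ℚ-positive (suc a) _ = subst (0ℚ <_) (sym (ℕ→ℚ≡mkℚ (suc a))) (positive⁻¹ _)

  ℕ→ℚ-mono-≤ : ∀ {a b} → a ℕ.≤ b → ℕ→ℚ a ≤ ℕ→ℚ b
  ℕ→ℚ-mono-≤ {a} {b} a≤b = begin
    ℕ→ℚ a                     ≡⟨ +-identityʳ (ℕ→ℚ a) ⟨
    ℕ→ℚ a + 0ℚ                ≤⟨ +-monoʳ-≤ (ℕ→ℚ a) (ℕ→ℚ-nonNegative (b ℕ.∸ a)) ⟩
    ℕ→ℚ a + ℕ→ℚ (b ℕ.∸ a)     ≡⟨ ℕ→ℚ-homo-+ a (b ℕ.∸ a) ⟨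
    ℕ→ℚ (a ℕ.+ (b ℕ.∸ a))     ≡⟨ cong ℕ→ℚ (ℕ.m+[n∸m]≡n a≤b) ⟩
    ℕ→ℚ b                     ∎
    where open ≤-Reasoning

  ℕ→ℚ-*-inverse : ∀ n → ℕ→ℚ (suc n) * (+ 1 / suc n) ≡ 1ℚ
  ℕ→ℚ-*-inverse n = begin
    ℕ→ℚ (suc n) * (+ 1 / suc n) ≡⟨ cong₂ _*_ (ℕ→ℚ≡mkℚ (suc n)) (normalize-coprime (Coprime.1-coprimeTo (suc n))) ⟩
    a * 1/ a                    ≡⟨ *-inverseʳ a ⟩
    1ℚ                          ∎
    where
    open ≡-Reasoning
    a = mkℚ (+ suc n) 0 (Coprime.sym (Coprime.1-coprimeTo (suc n)))

  ℕ→ℚ-*-cancelˡ : ∀ n x y → ℕ→ℚ (suc n) * x ≡ ℕ→ℚ (suc n) * y → x ≡ y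
  ℕ→ℚ-*-cancelˡ n x y eq = begin
    x               ≡⟨ *-identityˡ x ⟨
    1ℚ * x          ≡⟨ cong (_* x) (*-inverseˡ a) ⟨
    (1/ a * a) * x  ≡⟨ *-assoc (1/ a) a x ⟩
    1/ a * (a * x)  ≡⟨ cong (1/ a *_) (subst (λ b → b * x ≡ b * y) (ℕ→ℚ≡mkℚ (suc n)) eq) ⟩
    1/ a * (a * y)  ≡⟨ *-assoc (1/ a) a y ⟨
    (1/ a * a) * y  ≡⟨ cong (_* y) (*-inverseˡ a) ⟩
    1ℚ * y          ≡⟨ *-identityˡ y ⟩
    y               ∎
    where
    open ≡-Reasoning
    a = mkℚ (+ suc n) 0 (Coprime.sym (Coprime.1-coprimeTo (suc n)))

  recurrence-fixedPoint : ∀ n x q → ℕ→ℚ (suc n) * x + q ≡ 1ℚ → ℕ→ℚ (suc (suc n)) * q ≡ 1ℚ → x ≡ q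
  recurrence-fixedPoint n x q eq₁ eq₂ = ℕ→ℚ-*-cancelˡ n x q (∙-cancelʳ q _ _ (begin
    ℕ→ℚ (suc n) * x + q        ≡⟨ trans eq₁ (sym eq₂) ⟩
    ℕ→ℚ (suc (suc n)) * q      ≡⟨ cong (_* q) (ℕ→ℚ-homo-+ 1 (suc n)) ⟩
    (1ℚ + ℕ→ℚ (suc n)) * q     ≡⟨ solve 2 (λ a q → (con 1ℚ :+ a) :* q := a :* q :+ q) refl (ℕ→ℚ (suc n)) q ⟩
    ℕ→ℚ (suc n) * q + q        ∎))
    where open ≡-Reasoning; open +-*-Solver

module Sums where
  open import Data.Nat using (zero; _≡ᵇ_)
  import Data.Nat.Properties as ℕ
  open import Data.Product using (proj₁; proj₂)
  open import Data.Rational.Properties using (+-identityˡ; +-identityʳ; +-assoc; *-zeroˡ; *-zeroʳ; *-identityʳ; *-distribˡ-+)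
  open import Data.Rational.Solver using (module +-*-Solver)
  open import Relation.Binary.PropositionalEquality
  open ≡-Reasoning
  open import Defs using (ℕ→ℚ; sumFrom1)
  open EmbeddingProperties using (ℕ→ℚ-homo-+)
  open Counting using (indicator; countFrom; ≡ᵇ-refl; ≢⇒≡ᵇ-false)

  sumFrom : ℕ → ℕ → (ℕ → ℚ) → ℚ
  sumFrom a zero    g = 0ℚ
  sumFrom a (suc l) g = g a + sumFrom (suc a) l g

  sumFrom-+ : ∀ a l₁ l₂ g → sumFrom a (l₁ ℕ.+ l₂) g ≡ sumFrom a l₁ g + sumFrom (a ℕ.+ l₁) l₂ g
  sumFrom-+ a zero     l₂ g = trans (cong (λ b → sumFrom b l₂ g) (sym (ℕ.+-identityʳ a))) (sym (+-identityˡ _))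
  sumFrom-+ a (suc l₁) l₂ g = begin
    g a + sumFrom (suc a) (l₁ ℕ.+ l₂) g
      ≡⟨ cong (_+_ (g a)) (sumFrom-+ (suc a) l₁ l₂ g) ⟩
    g a + (sumFrom (suc a) l₁ g + sumFrom (suc a ℕ.+ l₁) l₂ g)
      ≡⟨ +-assoc (g a) _ _ ⟨
    sumFrom a (suc l₁) g + sumFrom (suc a ℕ.+ l₁) l₂ g
      ≡⟨ cong (λ b → sumFrom a (suc l₁) g + sumFrom b l₂ g) (ℕ.+-suc a l₁) ⟨
    sumFrom a (suc l₁) g + sumFrom (a ℕ.+ suc l₁) l₂ g ∎

  sumFrom-cong : ∀ a l {g h} → (∀ x → a ℕ.≤ x → x ℕ.< a ℕ.+ l → g x ≡ h x) → sumFrom a l g ≡ sumFrom a l h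
  sumFrom-cong a zero    g≡h = refl
  sumFrom-cong a (suc l) g≡h = cong₂ _+_ (g≡h a ℕ.≤-refl (ℕ.m<m+n a ℕ.z<s))
    (sumFrom-cong (suc a) l (λ x a<x x<a+l → g≡h x (ℕ.<⇒≤ a<x) (subst (x ℕ.<_) (sym (ℕ.+-suc a l)) x<a+l)))

  sumFrom-const : ∀ a l t → sumFrom a l (λ _ → t) ≡ ℕ→ℚ l * t
  sumFrom-const a zero    t = sym (*-zeroˡ t)
  sumFrom-const a (suc l) t = begin
    t + sumFrom (suc a) l (λ _ → t) ≡⟨ cong (_+_ t) (sumFrom-const (suc a) l t) ⟩
    t + ℕ→ℚ l * t                   ≡⟨ solve 2 (λ t L → t :+ L :* t := (con 1ℚ :+ L) :* t) refl t (ℕ→ℚ l) ⟩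
    (1ℚ + ℕ→ℚ l) * t                ≡⟨ cong (_* t) (ℕ→ℚ-homo-+ 1 l) ⟨
    ℕ→ℚ (suc l) * t                 ∎
    where open +-*-Solver

  sumFrom1-cong : ∀ K {f h} → (∀ i → i ℕ.≤ K → f i ≡ h i) → sumFrom1 K f ≡ sumFrom1 K h
  sumFrom1-cong zero    f≡h = refl
  sumFrom1-cong (suc K) f≡h = cong₂ _+_ (sumFrom1-cong K (λ i i≤K → f≡h i (ℕ.m≤n⇒m≤1+n i≤K))) (f≡h (suc K) ℕ.≤-refl)

  sumFrom1-zero : ∀ K → sumFrom1 K (λ _ → 0ℚ) ≡ 0ℚ
  sumFrom1-zero zero    = refl
  sumFrom1-zero (suc K) = trans (cong (_+ 0ℚ) (sumFrom1-zero K)) (+-identityʳ 0ℚ)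

  sumFrom1-+ : ∀ K f h → sumFrom1 K (λ i → f i + h i) ≡ sumFrom1 K f + sumFrom1 K h
  sumFrom1-+ zero    f h = sym (+-identityʳ 0ℚ)
  sumFrom1-+ (suc K) f h = begin
    sumFrom1 K (λ i → f i + h i) + (f (suc K) + h (suc K))
      ≡⟨ cong (_+ (f (suc K) + h (suc K))) (sumFrom1-+ K f h) ⟩
    (sumFrom1 K f + sumFrom1 K h) + (f (suc K) + h (suc K))
      ≡⟨ solve 4 (λ A B x y → (A :+ B) :+ (x :+ y) := (A :+ x) :+ (B :+ y)) refl (sumFrom1 K f) (sumFrom1 K h) (f (suc K)) (h (suc K)) ⟩
    (sumFrom1 K f + f (suc K)) + (sumFrom1 K h + h (suc K)) ∎
    where open +-*-Solver

  module _ (c : ℕ → ℚ) where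

    private
      selectAt : ℕ → ℕ → ℚ
      selectAt g i = c i * ℕ→ℚ (indicator (g ≡ᵇ i))

      selectAt-≢ : ∀ {g i} → g ≢ i → selectAt g i ≡ 0ℚ
      selectAt-≢ {g} {i} g≢i = trans (cong (λ b → c i * ℕ→ℚ (indicator b)) (≢⇒≡ᵇ-false g≢i)) (*-zeroʳ (c i))

      selectAt-≡ : ∀ g → selectAt g g ≡ c g
      selectAt-≡ g = trans (cong (λ b → c g * ℕ→ℚ (indicator b)) (≡ᵇ-refl g)) (*-identityʳ (c g))

    sumFrom1-select : ∀ K g → 1 ℕ.≤ g → g ℕ.≤ K → sumFrom1 K (selectAt g) ≡ c g
    sumFrom1-select zero    .zero () ℕ.z≤n
    sumFrom1-select (suc K) g 1≤g g≤1+K with ℕ.m≤n⇒m<n∨m≡n g≤1+K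
    ... | inj₂ refl = begin
      sumFrom1 K (selectAt (suc K)) + selectAt (suc K) (suc K)
        ≡⟨ cong₂ _+_ (trans (sumFrom1-cong K λ i i≤K → selectAt-≢ (λ 1+K≡i → ℕ.<-irrefl (sym 1+K≡i) (ℕ.s≤s i≤K)))
                            (sumFrom1-zero K))
                     (selectAt-≡ (suc K)) ⟩
      0ℚ + c (suc K)
        ≡⟨ +-identityˡ (c (suc K)) ⟩
      c (suc K) ∎
    ... | inj₁ (ℕ.s≤s g≤K) = begin
      sumFrom1 K (selectAt g) + selectAt g (suc K)
        ≡⟨ cong₂ _+_ (sumFrom1-select K g 1≤g g≤K) (selectAt-≢ (λ g≡1+K → ℕ.<-irrefl g≡1+K (ℕ.s≤s g≤K))) ⟩
      c g + 0ℚ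
        ≡⟨ +-identityʳ (c g) ⟩
      c g ∎

    sumFrom1-countFrom : ∀ K a l (q : ℕ → ℕ) → (∀ x → a ℕ.≤ x → x ℕ.< a ℕ.+ l → 1 ℕ.≤ q x × q x ℕ.≤ K) →
      sumFrom1 K (λ i → c i * ℕ→ℚ (countFrom a l (λ x → q x ≡ᵇ i))) ≡ sumFrom a l (λ x → c (q x))
    sumFrom1-countFrom K a zero    q q-range = trans (sumFrom1-cong K (λ i _ → *-zeroʳ (c i))) (sumFrom1-zero K)
    sumFrom1-countFrom K a (suc l) q q-range = begin
      sumFrom1 K (λ i → c i * ℕ→ℚ (indicator (q a ≡ᵇ i) ℕ.+ rest i))
        ≡⟨ sumFrom1-cong K (λ i _ → trans (cong (c i *_) (ℕ→ℚ-homo-+ (indicator (q a ≡ᵇ i)) (rest i)))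
                                          (*-distribˡ-+ (c i) _ _)) ⟩
      sumFrom1 K (λ i → selectAt (q a) i + c i * ℕ→ℚ (rest i))
        ≡⟨ sumFrom1-+ K _ _ ⟩
      sumFrom1 K (selectAt (q a)) + sumFrom1 K (λ i → c i * ℕ→ℚ (rest i))
        ≡⟨ cong₂ _+_ (sumFrom1-select K (q a) (proj₁ q-a) (proj₂ q-a))
                     (sumFrom1-countFrom K (suc a) l q λ x a<x x<a+l →
                        q-range x (ℕ.<⇒≤ a<x) (subst (x ℕ.<_) (sym (ℕ.+-suc a l)) x<a+l)) ⟩
      c (q a) + sumFrom (suc a) l (λ x → c (q x)) ∎
      where
      rest : ℕ → ℕ
      rest i = countFrom (suc a) l (λ x → q x ≡ᵇ i)
      q-a = q-range a ℕ.≤-refl (ℕ.m<m+n a ℕ.z<s)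

ViolatesBound : ℕ → (ℕ → ℚ) → ℚ → ℕ → Graph → Set
ViolatesBound Δ c ε j G = ∀ a → IsIndependenceNumber G a
  → ¬ (ε * ℕ→ℚ (numDeg G j) + sumFrom1 Δ (λ i → c i * ℕ→ℚ (numDeg G i)) ≤ ℕ→ℚ a)

violatesBound : ∀ G Δ c ε j s → 0ℚ < ε → 1 ℕ.≤ numDeg G j →
  sumFrom1 Δ (λ i → c i * ℕ→ℚ (numDeg G i)) ≡ ℕ→ℚ s →
  (∀ S → Independent G S → count (n G) S ℕ.≤ s) →
  ViolatesBound Δ c ε j G
violatesBound G Δ c ε j s ε>0 1≤nⱼ weight≡s independent≤s a ((S , S-independent , |S|≡a) , _) bound =
  <-irrefl refl (begin-strict
    ε * nⱼ + W  ≤⟨ bound ⟩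
    ℕ→ℚ a       ≤⟨ ℕ→ℚ-mono-≤ (subst (ℕ._≤ s) |S|≡a (independent≤s S S-independent)) ⟩
    ℕ→ℚ s       ≡⟨ +-identityˡ (ℕ→ℚ s) ⟨
    0ℚ + ℕ→ℚ s  <⟨ +-mono-<-≤ εnⱼ>0 (≤-reflexive (sym weight≡s)) ⟩
    ε * nⱼ + W  ∎)
  where
  open import Data.Rational.Properties using (<-irrefl; +-identityˡ; +-mono-<-≤; ≤-reflexive; positive⁻¹; pos*pos⇒pos; module ≤-Reasoning)
  open import Data.Rational using (positive)
  open import Relation.Binary.PropositionalEquality using (refl; sym; subst)
  open ≤-Reasoning
  open EmbeddingProperties using (ℕ→ℚ-mono-≤; ℕ→ℚ-positive)
  nⱼ = ℕ→ℚ (numDeg G j)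
  W  = sumFrom1 Δ (λ i → c i * ℕ→ℚ (numDeg G i))
  εnⱼ>0 : 0ℚ < ε * nⱼ
  εnⱼ>0 = positive⁻¹ (ε * nⱼ) {{pos*pos⇒pos ε {{positive ε>0}} nⱼ {{positive (ℕ→ℚ-positive _ 1≤nⱼ)}}}}

module WeightedChain (d-1 m r : ℕ) (1≤m : 1 ℕ.≤ m) (2≤r : 2 ℕ.≤ r) (r≤d : r ℕ.≤ suc d-1) (c : ℕ → ℚ)
                   (c-d-1 : c d-1 ≡ + 1 / suc d-1) (c-d : c (suc d-1) ≡ + 1 / suc d-1)
                   (c-last : ℕ→ℚ (r ℕ.∸ 1) * c (r ℕ.∸ 1) + c r ≡ 1ℚ) where
  open import Data.Nat using (zero; z≤n; s≤s; _≡ᵇ_)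
  import Data.Nat.Properties as ℕ
  open import Data.Rational.Properties using (+-comm)
  open import Relation.Binary.PropositionalEquality hiding (_≡_)
  open ≡-Reasoning
  open ChainOfCliques d-1 m r 1≤m 2≤r r≤d
  open Counting using (countFrom)
  open EmbeddingProperties
  open Sums

  weight : ℕ → ℚ
  weight x = c (degree x)

  full-block-weight : ∀ b t → b ℕ.+ suc t ≡ m → sumFrom (b ℕ.* d) d weight ≡ 1ℚ
  full-block-weight b t b+1+t≡m = begin
    sumFrom (b ℕ.* d) d weight          ≡⟨ sumFrom-cong (b ℕ.* d) d weight≡1/d ⟩
    sumFrom (b ℕ.* d) d (λ _ → + 1 / d) ≡⟨ sumFrom-const (b ℕ.* d) d (+ 1 / d) ⟩
    ℕ→ℚ d * (+ 1 / d)                   ≡⟨ ℕ→ℚ-*-inverse d-1 ⟩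
    1ℚ                                  ∎
    where
    weight≡1/d : ∀ x → b ℕ.* d ℕ.≤ x → x ℕ.< b ℕ.* d ℕ.+ d → weight x ≡ + 1 / d
    weight≡1/d x bd≤x x<bd+d with degree-in-full-block b t x b+1+t≡m bd≤x x<bd+d
    ... | inj₁ deg≡d-1 = trans (cong c deg≡d-1) c-d-1
    ... | inj₂ deg≡d   = trans (cong c deg≡d) c-d

  last-block-weight : sumFrom (m ℕ.* d) r weight ≡ 1ℚ
  last-block-weight = begin
    sumFrom (m ℕ.* d) r weight
      ≡⟨ cong (λ l → sumFrom (m ℕ.* d) l weight) (sym 1+r-1≡r) ⟩
    weight (m ℕ.* d) + sumFrom (suc (m ℕ.* d)) (r ℕ.∸ 1) weight
      ≡⟨ cong₂ _+_ (cong c degree-first-of-last-block) rest-weight ⟩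
    c r + ℕ→ℚ (r ℕ.∸ 1) * c (r ℕ.∸ 1)
      ≡⟨ +-comm (c r) _ ⟩
    ℕ→ℚ (r ℕ.∸ 1) * c (r ℕ.∸ 1) + c r
      ≡⟨ c-last ⟩
    1ℚ ∎
    where
    1+r-1≡r : suc (r ℕ.∸ 1) ≡ r
    1+r-1≡r = ℕ.m+[n∸m]≡n (ℕ.≤-trans (s≤s z≤n) 2≤r)
    rest-weight : sumFrom (suc (m ℕ.* d)) (r ℕ.∸ 1) weight ≡ ℕ→ℚ (r ℕ.∸ 1) * c (r ℕ.∸ 1)
    rest-weight = trans (sumFrom-cong (suc (m ℕ.* d)) (r ℕ.∸ 1) λ x md<x x<order →
                           cong c (ℕ.suc-injective (trans (degree-rest-of-last-block x md<x
                             (subst (x ℕ.<_) (trans (sym (ℕ.+-suc (m ℕ.* d) _)) (cong (m ℕ.* d ℕ.+_) 1+r-1≡r)) x<order))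
                             (sym 1+r-1≡r))))
                        (sumFrom-const (suc (m ℕ.* d)) (r ℕ.∸ 1) (c (r ℕ.∸ 1)))

  blocks-weight : ∀ t b → b ℕ.+ t ≡ m → sumFrom (b ℕ.* d) (t ℕ.* d ℕ.+ r) weight ≡ ℕ→ℚ (suc t)
  blocks-weight zero    b b+0≡m = trans (cong (λ b → sumFrom (b ℕ.* d) r weight) (trans (sym (ℕ.+-identityʳ b)) b+0≡m)) last-block-weight
  blocks-weight (suc t) b b+1+t≡m = begin
    sumFrom (b ℕ.* d) (suc t ℕ.* d ℕ.+ r) weight
      ≡⟨ cong (λ l → sumFrom (b ℕ.* d) l weight) (ℕ.+-assoc d (t ℕ.* d) r) ⟩
    sumFrom (b ℕ.* d) (d ℕ.+ (t ℕ.* d ℕ.+ r)) weight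
      ≡⟨ sumFrom-+ (b ℕ.* d) d _ weight ⟩
    sumFrom (b ℕ.* d) d weight + sumFrom (b ℕ.* d ℕ.+ d) (t ℕ.* d ℕ.+ r) weight
      ≡⟨ cong (λ a → sumFrom (b ℕ.* d) d weight + sumFrom a (t ℕ.* d ℕ.+ r) weight) (ℕ.+-comm (b ℕ.* d) d) ⟩
    sumFrom (b ℕ.* d) d weight + sumFrom (suc b ℕ.* d) (t ℕ.* d ℕ.+ r) weight
      ≡⟨ cong₂ _+_ (full-block-weight b t b+1+t≡m) (blocks-weight t (suc b) (trans (sym (ℕ.+-suc b t)) b+1+t≡m)) ⟩
    1ℚ + ℕ→ℚ (suc t)
      ≡⟨ ℕ→ℚ-homo-+ 1 (suc t) ⟨
    ℕ→ℚ (suc (suc t)) ∎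

  chain-weight : sumFrom1 d (λ i → c i * ℕ→ℚ (numDeg chain i)) ≡ ℕ→ℚ (suc m)
  chain-weight = begin
    sumFrom1 d (λ i → c i * ℕ→ℚ (numDeg chain i))
      ≡⟨ sumFrom1-cong d (λ i _ → cong (λ k → c i * ℕ→ℚ k) (numDeg≡countFrom i)) ⟩
    sumFrom1 d (λ i → c i * ℕ→ℚ (countFrom 0 order (λ x → degree x ≡ᵇ i)))
      ≡⟨ sumFrom1-countFrom c d 0 order degree (λ x _ → degree-bounds x) ⟩
    sumFrom 0 order weight
      ≡⟨ blocks-weight m 0 refl ⟩
    ℕ→ℚ (suc m) ∎

  counterexample : ∀ ε j N → 0ℚ < ε → 1 ℕ.≤ numDeg chain j → N ℕ.< m →
    Σ Graph λ G → N ℕ.< n G × InClass d G × ViolatesBound d c ε j G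
  counterexample ε j N ε>0 1≤nⱼ N<m =
    chain , ℕ.<-≤-trans N<m (ℕ.≤-trans (ℕ.m≤m*n m d) (ℕ.m≤m+n (m ℕ.* d) r)) ,
    (chain-connected , chain-maxDegree , chain-not-complete) ,
    violatesBound chain d c ε j (suc m) ε>0 1≤nⱼ chain-weight chain-independent≤

chain-counterexamples : ∀ d-1 → 1 ℕ.≤ d-1 → (c : ℕ → ℚ) → c d-1 ≡ + 1 / suc d-1 → c (suc d-1) ≡ + 1 / suc d-1 →
  (∀ i → 1 ℕ.≤ i → i ℕ.≤ d-1 → ℕ→ℚ i * c i + c (suc i) ≡ 1ℚ) →
  ∀ ε → 0ℚ < ε → ∀ j → 1 ℕ.≤ j → j ℕ.≤ suc d-1 →
  ∀ N → Σ Graph λ G → N ℕ.< n G × InClass (suc d-1) G × ViolatesBound (suc d-1) c ε j G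
chain-counterexamples d-1 1≤d-1 c c-d-1 c-d rec ε ε>0 j 1≤j j≤d N with m≤n⇒m<n∨m≡n j≤d
... | inj₁ j<d  = WeightedChain.counterexample d-1 (suc N) (suc j) ℕ.z<s (ℕ.s≤s 1≤j) j<d c c-d-1 c-d (rec j 1≤j (≤-pred j<d))
                   ε j N ε>0 (ChainOfCliques.numDeg-r-1≥1 d-1 (suc N) (suc j) ℕ.z<s (ℕ.s≤s 1≤j) j<d) (n<1+n N)
... | inj₂ refl = WeightedChain.counterexample d-1 (suc N) (suc d-1) ℕ.z<s (ℕ.s≤s 1≤d-1) ≤-refl c c-d-1 c-d (rec d-1 1≤d-1 ≤-refl)
                   ε (suc d-1) N ε>0 (ChainOfCliques.numDeg-d≥1 d-1 (suc N) (suc d-1) ℕ.z<s (ℕ.s≤s 1≤d-1) ≤-refl) (n<1+n N)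

theorem3 : (Δ : ℕ) → 3 ℕ.≤ Δ → .{{_ : NonZero Δ}}
    → (c : ℕ → ℚ)
    → c Δ ≡ + 1 / Δ
    → (∀ i → 1 ℕ.≤ i → i ℕ.≤ Δ ℕ.∸ 1 → ℕ→ℚ i * c i + c (suc i) ≡ 1ℚ)
    → (ε : ℚ) → 0ℚ < ε
    → (j : ℕ) → 1 ℕ.≤ j → j ℕ.≤ Δ
    → (N : ℕ) → Σ Graph λ G → N ℕ.< n G × InClass Δ G
    × (∀ a → IsIndependenceNumber G a
    → ¬ (ε * ℕ→ℚ (numDeg G j) + sumFrom1 Δ (λ i → c i * ℕ→ℚ (numDeg G i)) ≤ ℕ→ℚ a))
theorem3 (suc (suc (suc k))) (ℕ.s≤s (ℕ.s≤s (ℕ.s≤s ℕ.z≤n))) c c-Δ rec =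
  chain-counterexamples (suc (suc k)) ℕ.z<s c c-Δ-1 c-Δ rec
  where
  open import Relation.Binary.PropositionalEquality using (trans; cong; sym)
  open EmbeddingProperties using (recurrence-fixedPoint; ℕ→ℚ-*-inverse)
  c-Δ-1 : c (suc (suc k)) ≡ + 1 / suc (suc (suc k))
  c-Δ-1 = recurrence-fixedPoint (suc k) _ _
    (trans (cong (_+_ (ℕ→ℚ (suc (suc k)) * c (suc (suc k)))) (sym c-Δ)) (rec (suc (suc k)) ℕ.z<s ≤-refl))
    (ℕ→ℚ-*-inverse (suc (suc k)))
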